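{- Let $G_\tau$ be a bidirected graph and $\mathrm{Rt}(G_\tau)$ a transitive reduction of $G_\tau$. Then (i) $\mathrm{Rt}(G_\tau)$ is balanced if, and only if, $G_\tau$ is balanced; (ii) $\mathrm{Rt}(G_\tau)$ is all positive if, and only if, $G_\tau$ is all positive.
   Context: A graph $G=(V,E)$ is finite, with loops and multiple edges allowed. A half-edge is a pair $(e,x)$ with $e$ incident with $x$ (a loop has two half-edges at its vertex). A bidirected graph $G_\tau=(V,E;\tau)$ is a graph with a map $\tau$ assigning $+1$ or $-1$ to every half-edge; an edge with ends $x,y$ and $\tau(e,x)=\alpha,\tau(e,y)=\beta$ is written $\{x^\alpha,y^\beta\}$ and has sign $-\alpha\beta$. A bidirected graph is all positive if all its edges have sign $+1$, and balanced if every cycle has an even number of negative edges. A partial graph of $G_\tau$ is $(V,F;\tau|_F)$ with $F\subseteq E$. A chain is $x_0,e_1,x_1,\ldots,e_k,x_k$ where $e_i$ has ends $x_{i-1},x_i$; when $e_i$ is traversed from $x_{i-1}$ to $x_i$, $\tau(e_i,x_{i-1}),\tau(e_i,x_i)$ denote the values at the corresponding half-edges. For $\alpha,\beta\in\{\pm1\}$ a b-walk from $x^\alpha$ to $y^\beta$ is a chain $x=x_0,e_1,\ldots,e_k,x_k=y$ with $k\ge1$, $\tau(e_1,x_0)=\alpha$, $\tau(e_k,x_k)=\beta$ and $\tau(e_i,x_i)+\tau(e_{i+1},x_i)=0$ for $1\le i\le k-1$. A b-path from $x^\alpha$ to $y^\beta$ is a b-walk from $x^\alpha$ to $y^\beta$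 minimal with these properties (no b-walk from $x^\alpha$ to $y^\beta$ has as edge sequence a proper subsequence, in the same order, of its edge sequence); $x=y$ allowed. For a partial graph $H_\tau$ of $G_\tau$, $\mathrm{ft}(G_\tau;H_\tau)$ is the partial graph of $G_\tau$ whose edges are the edges of $G_\tau$ that are edges of $H_\tau$ or are of the form $\{x^\alpha,y^\beta\}$ with a b-path from $x^\alpha$ to $y^\beta$ in $H_\tau$. A transitive reduction of $G_\tau$ is a minimal partial graph $R$ of $G_\tau$ with $\mathrm{ft}(G_\tau;R)=G_\tau$. -}

module Defs where

open import Data.Nat using (ℕ; zero; suc; _<_)
open import Data.Nat.Divisibility using (_∣_)
open import Data.Fin using (Fin)
open import Data.Fin.Subset using (Subset; _∈_; _⊂_) renaming (⊤ to Full)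
open import Data.Bool using (Bool; true; false)
open import Data.List using (List; []; _∷_; map; length)
open import Data.List.Relation.Unary.All using (All)
open import Data.List.Relation.Binary.Sublist.Propositional using (_⊆_)
open import Data.List.Relation.Unary.Unique.Propositional using (Unique)
open import Data.Product using (Σ; ∃; _×_; _,_; proj₁; proj₂)
open import Data.Sum using (_⊎_)
open import Relation.Binary.PropositionalEquality using (_≡_; _≢_)
open import Relation.Nullary using (¬_)

data Sign : Set where
  ⊕ ⊖ : Sign

neg : Sign → Sign
neg ⊕ = ⊖
neg ⊖ = ⊕

_·_ : Sign → Sign → Sign
⊕ · s = s
⊖ · s = neg s

-- Edge e has two half-edges: (e, end₁ e) with value τ₁ e and (e, end₂ e)
-- with value τ₂ e.  A loop has end₁ e ≡ end₂ e, still two half-edges.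
record BGraph : Set where
  field
    nV nE : ℕ
    end₁ end₂ : Fin nE → Fin nV
    τ₁ τ₂ : Fin nE → Sign
open BGraph public

edgeSign : (G : BGraph) → Fin (nE G) → Sign
edgeSign G e = neg (τ₁ G e · τ₂ G e)

-- A step of a chain: an edge with a traversal direction
-- (true: end₁ → end₂, false: end₂ → end₁).
Step : BGraph → Set
Step G = Fin (nE G) × Bool

edgeOf : (G : BGraph) → Step G → Fin (nE G)
edgeOf G = proj₁

depV arrV : (G : BGraph) → Step G → Fin (nV G)
depV G (e , true)  = end₁ G e
depV G (e , false) = end₂ G e
arrV G (e , true)  = end₂ G e
arrV G (e , false) = end₁ G e

depS arrS : (G : BGraph) → Step G → Sign
depS G (e , true)  = τ₁ G e
depS G (e , false) = τ₂ G e
arrS G (e , true)  = τ₂ G e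
arrS G (e , false) = τ₁ G e

edges : (G : BGraph) → List (Step G) → List (Fin (nE G))
edges G = map proj₁

data IsBWalk (G : BGraph) (F : Subset (nE G)) :
       Fin (nV G) → Sign → List (Step G) → Fin (nV G) → Sign → Set where
  one  : ∀ s → proj₁ s ∈ F →
         IsBWalk G F (depV G s) (depS G s) (s ∷ []) (arrV G s) (arrS G s)
  more : ∀ s {ws y β} → proj₁ s ∈ F →
         IsBWalk G F (arrV G s) (neg (arrS G s)) ws y β →
         IsBWalk G F (depV G s) (depS G s) (s ∷ ws) y β

IsBPath : (G : BGraph) (F : Subset (nE G)) →
          Fin (nV G) → Sign → List (Step G) → Fin (nV G) → Sign → Set
IsBPath G F x α ws y β =
  IsBWalk G F x α ws y β ×
  (∀ ws′ → IsBWalk G F x α ws′ y β →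
     ¬ (edges G ws′ ⊆ edges G ws × length ws′ < length ws))

InFt : (G : BGraph) (F : Subset (nE G)) → Fin (nE G) → Set
InFt G F e =
  e ∈ F ⊎
  ((∃ λ ws → IsBPath G F (end₁ G e) (τ₁ G e) ws (end₂ G e) (τ₂ G e)) ⊎
   (∃ λ ws → IsBPath G F (end₂ G e) (τ₂ G e) ws (end₁ G e) (τ₁ G e)))

FtIsAll : (G : BGraph) → Subset (nE G) → Set
FtIsAll G F = ∀ e → InFt G F e

IsTransitiveReduction : (G : BGraph) → Subset (nE G) → Set
IsTransitiveReduction G R =
  FtIsAll G R × (∀ R′ → R′ ⊂ R → ¬ FtIsAll G R′)

data IsChain (G : BGraph) : Fin (nV G) → List (Step G) → Fin (nV G) → Set where
  []  : ∀ {x} → IsChain G x [] x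
  _∷_ : ∀ {s ws y} → IsChain G (arrV G s) ws y → IsChain G (depV G s) (s ∷ ws) y

IsCycle : (G : BGraph) → Subset (nE G) → List (Step G) → Set
IsCycle G F ws =
  (∃ λ x → IsChain G x ws x) × ws ≢ [] ×
  All (λ s → proj₁ s ∈ F) ws ×
  Unique (edges G ws) × Unique (map (depV G) ws)

countNeg : (G : BGraph) → List (Fin (nE G)) → ℕ
countNeg G [] = zero
countNeg G (e ∷ es) with edgeSign G e
... | ⊕ = countNeg G es
... | ⊖ = suc (countNeg G es)

Balanced : (G : BGraph) → Subset (nE G) → Set
Balanced G F = ∀ ws → IsCycle G F ws → 2 ∣ countNeg G (edges G ws)

AllPositive : (G : BGraph) → Subset (nE G) → Set
AllPositive G F = ∀ e → e ∈ F → edgeSign G e ≡ ⊕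

allEdges : (G : BGraph) → Subset (nE G)
allEdges G = Full

module Submission where

-- A b-walk from x^α to y^β has sign -αβ, so ft(G;R) = G lets every edge of G be replaced by a walk in R
-- of the same sign. Hence every closed walk of G has the sign of a closed
-- walk in R, and if R is balanced every closed walk in R is positive, by induction on its length.
-- The converse implications hold because R is a partial graph of G.

open import Defs
open import Data.Fin.Subset using (Subset)
open import Data.Product using (_×_)
open import Function.Bundles using (_⇔_)

open import Data.Bool using (true; false; not)
open import Data.Fin using (Fin; _≟_)
open import Data.Fin.Subset using (_∈_; _⊆_)
open import Data.Fin.Subset.Properties using (⊆⊤)
open import Data.List using (List; []; _∷_; map; length; _++_; _ʳ++_)
open import Data.List.Properties using (length-++-≤ˡ; length-++-≤ʳ; length-++-sucʳ)
open import Data.List.Membership.Propositional using (find)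
open import Data.List.Membership.Propositional.Properties using (∈-∃++)
open import Data.List.Relation.Unary.All as All using (All; []; _∷_)
open import Data.List.Relation.Unary.All.Properties using (¬Any⇒All¬; ++⁺; ++⁻ˡ; ++⁻ʳ)
  renaming (map⁺ to All-map⁺)
open import Data.List.Relation.Unary.AllPairs using ([]; _∷_)
open import Data.List.Relation.Unary.Any using (any?)
open import Data.List.Relation.Unary.Unique.Propositional using (Unique)
open import Data.Nat using (ℕ; zero; suc; _*_; _<_; s≤s)
open import Data.Nat.Divisibility using (_∣_; divides)
open import Data.Nat.Induction using (<-wellFounded)
open import Data.Nat.Properties using (<-trans; <-≤-trans; n<1+n)
open import Data.Product using (∃; _,_; proj₁)
open import Data.Sum using (_⊎_; inj₁; inj₂)
open import Function using (_on_)
open import Function.Bundles using (mk⇔)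
open import Induction.WellFounded using (WellFounded; WfRec)
import Induction.WellFounded as WF
import Relation.Binary.Construct.On as On
open import Relation.Binary.Definitions using (DecidableEquality)
open import Relation.Binary.PropositionalEquality
open import Relation.Nullary using (yes; no)

neg-involutive : ∀ a → neg (neg a) ≡ a
neg-involutive ⊕ = refl
neg-involutive ⊖ = refl

·-identityʳ : ∀ a → a · ⊕ ≡ a
·-identityʳ ⊕ = refl
·-identityʳ ⊖ = refl

·-comm : ∀ a b → a · b ≡ b · a
·-comm ⊕ ⊕ = refl
·-comm ⊕ ⊖ = refl
·-comm ⊖ ⊕ = refl
·-comm ⊖ ⊖ = refl

·-assoc : ∀ a b c → (a · b) · c ≡ a · (b · c)
·-assoc ⊕ b c = refl
·-assoc ⊖ ⊕ c = refl
·-assoc ⊖ ⊖ c = sym (neg-involutive c)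

·-self-inverse : ∀ a b → a · (a · b) ≡ b
·-self-inverse ⊕ b = refl
·-self-inverse ⊖ b = neg-involutive b

-- Two consecutive edges of a b-walk carry opposite values at their common vertex.
b-junction : ∀ α β γ → neg (α · β) · neg (neg β · γ) ≡ neg (α · γ)
b-junction ⊕ ⊕ γ = neg-involutive (neg γ)
b-junction ⊕ ⊖ γ = refl
b-junction ⊖ ⊕ γ = refl
b-junction ⊖ ⊖ γ = refl

⊖^_ : ℕ → Sign
⊖^ zero  = ⊕
⊖^ suc n = neg (⊖^ n)

⊖^-even : ∀ {n} → 2 ∣ n → ⊖^ n ≡ ⊕
⊖^-even (divides q refl) = ⊖^[q*2]≡⊕ q
  where
  ⊖^[q*2]≡⊕ : ∀ q → ⊖^ (q * 2) ≡ ⊕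
  ⊖^[q*2]≡⊕ zero    = refl
  ⊖^[q*2]≡⊕ (suc q) = trans (neg-involutive _) (⊖^[q*2]≡⊕ q)

⊖^≡⊕⇒even : ∀ n → ⊖^ n ≡ ⊕ → 2 ∣ n
⊖^≡⊕⇒even zero          _ = divides 0 refl
⊖^≡⊕⇒even (suc zero)    ()
⊖^≡⊕⇒even (suc (suc n)) p with ⊖^≡⊕⇒even n (trans (sym (neg-involutive (⊖^ n))) p)
... | divides q refl = divides (suc q) refl

module _ {A X : Set} (f : A → X) where

  record Repetition (xs : List A) : Set where
    constructor repetition
    field
      pre : List A
      first : A
      mid : List A
      second : A
      post : List A
      split : xs ≡ pre ++ first ∷ mid ++ second ∷ post
      same : f first ≡ f second

  unique⊎repetition : DecidableEquality X → ∀ xs → Unique (map f xs) ⊎ Repetition xs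
  unique⊎repetition _≟X_ []       = inj₁ []
  unique⊎repetition _≟X_ (x ∷ xs) with any? (λ y → f x ≟X f y) xs
  ... | yes fx∈fxs with find fx∈fxs
  ...   | y , y∈xs , fx≡fy with ∈-∃++ y∈xs
  ...     | mid , post , refl = inj₂ (repetition [] x mid y post refl fx≡fy)
  unique⊎repetition _≟X_ (x ∷ xs) | no fx∉fxs with unique⊎repetition _≟X_ xs
  ... | inj₁ u = inj₁ (All-map⁺ (¬Any⇒All¬ xs fx∉fxs) ∷ u)
  ... | inj₂ (repetition pre b mid c post refl same) =
    inj₂ (repetition (x ∷ pre) b mid c post refl same)

module _ {A : Set} where

  length-<-++-∷ : ∀ (xs : List A) y ys → length xs < length (xs ++ y ∷ ys)
  length-<-++-∷ xs y ys =
    subst (length xs <_) (sym (length-++-sucʳ xs y ys)) (s≤s (length-++-≤ˡ xs))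

  length-++-<-insert : ∀ (xs : List A) y ys zs → length (xs ++ zs) < length (xs ++ y ∷ ys ++ zs)
  length-++-<-insert []       y ys zs = s≤s (length-++-≤ʳ zs {ys})
  length-++-<-insert (_ ∷ xs) y ys zs = s≤s (length-++-<-insert xs y ys zs)

module _ (G : BGraph) where

  reverseStep : Step G → Step G
  reverseStep (e , d) = e , not d

  depV-reverseStep : ∀ s → depV G (reverseStep s) ≡ arrV G s
  depV-reverseStep (e , true)  = refl
  depV-reverseStep (e , false) = refl

  arrV-reverseStep : ∀ s → arrV G (reverseStep s) ≡ depV G s
  arrV-reverseStep (e , true)  = refl
  arrV-reverseStep (e , false) = refl

  same-edge⇒≡⊎reversed : ∀ (s t : Step G) → proj₁ s ≡ proj₁ t → s ≡ t ⊎ t ≡ reverseStep s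
  same-edge⇒≡⊎reversed (e , true)  (.e , true)  refl = inj₁ refl
  same-edge⇒≡⊎reversed (e , true)  (.e , false) refl = inj₂ refl
  same-edge⇒≡⊎reversed (e , false) (.e , true)  refl = inj₂ refl
  same-edge⇒≡⊎reversed (e , false) (.e , false) refl = inj₁ refl

  edgeSign-step : ∀ s → edgeSign G (proj₁ s) ≡ neg (depS G s · arrS G s)
  edgeSign-step (e , true)  = refl
  edgeSign-step (e , false) = cong neg (·-comm (τ₁ G e) (τ₂ G e))

  chainSign : List (Step G) → Sign
  chainSign []       = ⊕
  chainSign (s ∷ ws) = edgeSign G (proj₁ s) · chainSign ws

  chainSign≡⊖^countNeg : ∀ ws → chainSign ws ≡ ⊖^ countNeg G (edges G ws)
  chainSign≡⊖^countNeg [] = refl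
  chainSign≡⊖^countNeg (s ∷ ws) with edgeSign G (proj₁ s)
  ... | ⊕ = chainSign≡⊖^countNeg ws
  ... | ⊖ = cong neg (chainSign≡⊖^countNeg ws)

  chainSign-++ : ∀ xs ys → chainSign (xs ++ ys) ≡ chainSign xs · chainSign ys
  chainSign-++ []       ys = refl
  chainSign-++ (s ∷ xs) ys = begin
    edgeSign G (proj₁ s) · chainSign (xs ++ ys)          ≡⟨ cong (edgeSign G (proj₁ s) ·_) (chainSign-++ xs ys) ⟩
    edgeSign G (proj₁ s) · (chainSign xs · chainSign ys) ≡⟨ sym (·-assoc (edgeSign G (proj₁ s)) _ _) ⟩
    chainSign (s ∷ xs) · chainSign ys                    ∎
    where open ≡-Reasoning

  chainSign-ʳ++ : ∀ xs acc → chainSign (map reverseStep xs ʳ++ acc) ≡ chainSign xs · chainSign acc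
  chainSign-ʳ++ []       acc = refl
  chainSign-ʳ++ (s ∷ xs) acc = begin
    chainSign (map reverseStep xs ʳ++ reverseStep s ∷ acc) ≡⟨ chainSign-ʳ++ xs (reverseStep s ∷ acc) ⟩
    chainSign xs · (σ · chainSign acc)                     ≡⟨ sym (·-assoc (chainSign xs) σ _) ⟩
    (chainSign xs · σ) · chainSign acc                     ≡⟨ cong (_· chainSign acc) (·-comm (chainSign xs) σ) ⟩
    (σ · chainSign xs) · chainSign acc                     ∎
    where
    open ≡-Reasoning
    σ = edgeSign G (proj₁ s)

  chainSign-excise : ∀ xs {ys} zs → chainSign ys ≡ ⊕ → chainSign (xs ++ ys ++ zs) ≡ chainSign (xs ++ zs)
  chainSign-excise xs {ys} zs ys⊕ = begin
    chainSign (xs ++ ys ++ zs)                   ≡⟨ chainSign-++ xs (ys ++ zs) ⟩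
    chainSign xs · chainSign (ys ++ zs)          ≡⟨ cong (chainSign xs ·_) (chainSign-++ ys zs) ⟩
    chainSign xs · (chainSign ys · chainSign zs) ≡⟨ cong (λ σ → chainSign xs · (σ · chainSign zs)) ys⊕ ⟩
    chainSign xs · chainSign zs                  ≡⟨ sym (chainSign-++ xs zs) ⟩
    chainSign (xs ++ zs)                         ∎
    where open ≡-Reasoning

  chainSign-cancel-backtrack : ∀ xs s {ys} zs → chainSign ys ≡ ⊕ →
                               chainSign (xs ++ s ∷ ys ++ reverseStep s ∷ zs) ≡ chainSign (xs ++ zs)
  chainSign-cancel-backtrack xs s {ys} zs ys⊕ = begin
    chainSign (xs ++ s ∷ ys ++ reverseStep s ∷ zs)            ≡⟨ chainSign-++ xs _ ⟩
    chainSign xs · (σ · chainSign (ys ++ reverseStep s ∷ zs)) ≡⟨ cong (λ τ → chainSign xs · (σ · τ)) ys-excised ⟩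
    chainSign xs · (σ · (σ · chainSign zs))                   ≡⟨ cong (chainSign xs ·_) (·-self-inverse σ _) ⟩
    chainSign xs · chainSign zs                               ≡⟨ sym (chainSign-++ xs zs) ⟩
    chainSign (xs ++ zs)                                      ∎
    where
    open ≡-Reasoning
    σ = edgeSign G (proj₁ s)
    ys-excised : chainSign (ys ++ reverseStep s ∷ zs) ≡ chainSign (reverseStep s ∷ zs)
    ys-excised = chainSign-excise [] {ys} (reverseStep s ∷ zs) ys⊕

  IsChain-++ : ∀ {x m y xs ys} → IsChain G x xs m → IsChain G m ys y → IsChain G x (xs ++ ys) y
  IsChain-++ []      d = d
  IsChain-++ (_∷_ c) d = _∷_ (IsChain-++ c d)

  IsChain-++⁻ : ∀ xs {ys x y} → IsChain G x (xs ++ ys) y → ∃ λ m → IsChain G x xs m × IsChain G m ys y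
  IsChain-++⁻ []       c       = _ , [] , c
  IsChain-++⁻ (s ∷ xs) (_∷_ c) with IsChain-++⁻ xs c
  ... | m , c₁ , c₂ = m , _∷_ c₁ , c₂

  IsChain-ʳ++ : ∀ {x y z} xs {acc} → IsChain G x xs y → IsChain G x acc z →
                IsChain G y (map reverseStep xs ʳ++ acc) z
  IsChain-ʳ++ []                []      d = d
  IsChain-ʳ++ ((e , true)  ∷ xs) (_∷_ c) d = IsChain-ʳ++ xs c (_∷_ d)
  IsChain-ʳ++ ((e , false) ∷ xs) (_∷_ c) d = IsChain-ʳ++ xs c (_∷_ d)

  StepsIn : Subset (nE G) → List (Step G) → Set
  StepsIn F = All (λ s → proj₁ s ∈ F)

  StepsIn-ʳ++ : ∀ {F} xs {acc} → StepsIn F xs → StepsIn F acc → StepsIn F (map reverseStep xs ʳ++ acc)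
  StepsIn-ʳ++ []       []       b = b
  StepsIn-ʳ++ (s ∷ xs) (p ∷ ps) b = StepsIn-ʳ++ xs ps (p ∷ b)

  record SignedWalk (F : Subset (nE G)) (x y : Fin (nV G)) (σ : Sign) : Set where
    constructor walk
    field
      steps : List (Step G)
      chain : IsChain G x steps y
      inF   : StepsIn F steps
      sign  : chainSign steps ≡ σ

  SignedWalk-++ : ∀ {F x m y σ ρ} → SignedWalk F x m σ → SignedWalk F m y ρ → SignedWalk F x y (σ · ρ)
  SignedWalk-++ (walk xs c a p) (walk ys d b q) =
    walk (xs ++ ys) (IsChain-++ c d) (++⁺ a b) (trans (chainSign-++ xs ys) (cong₂ _·_ p q))

  SignedWalk-reverse : ∀ {F x y σ} → SignedWalk F x y σ → SignedWalk F y x σ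
  SignedWalk-reverse (walk xs c a p) =
    walk (map reverseStep xs ʳ++ []) (IsChain-ʳ++ xs c []) (StepsIn-ʳ++ xs a [])
         (trans (chainSign-ʳ++ xs []) (trans (·-identityʳ _) p))

  bWalk⇒SignedWalk : ∀ {F x α ws y β} → IsBWalk G F x α ws y β → SignedWalk F x y (neg (α · β))
  bWalk⇒SignedWalk (one s p) = walk (s ∷ []) (_∷_ []) (p ∷ []) (trans (·-identityʳ _) (edgeSign-step s))
  bWalk⇒SignedWalk {β = β} (more s p w) with bWalk⇒SignedWalk w
  ... | walk ws c a q = walk (s ∷ ws) (_∷_ c) (p ∷ a)
    (trans (cong₂ _·_ (edgeSign-step s) q) (b-junction (depS G s) (arrS G s) β))

  ft-edge-walk : ∀ {F e} → InFt G F e → SignedWalk F (end₁ G e) (end₂ G e) (edgeSign G e)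
  ft-edge-walk {e = e} (inj₁ e∈F) = walk ((e , true) ∷ []) (_∷_ []) (e∈F ∷ []) (·-identityʳ _)
  ft-edge-walk (inj₂ (inj₁ (_ , w , _))) = bWalk⇒SignedWalk w
  ft-edge-walk {e = e} (inj₂ (inj₂ (_ , w , _))) =
    SignedWalk-reverse (subst (SignedWalk _ _ _) (cong neg (·-comm (τ₂ G e) (τ₁ G e))) (bWalk⇒SignedWalk w))

  ft-step-walk : ∀ {F} s → InFt G F (proj₁ s) → SignedWalk F (depV G s) (arrV G s) (edgeSign G (proj₁ s))
  ft-step-walk (e , true)  p = ft-edge-walk p
  ft-step-walk (e , false) p = SignedWalk-reverse (ft-edge-walk p)

  ft-chain-walk : ∀ {F x y ws} → FtIsAll G F → IsChain G x ws y → SignedWalk F x y (chainSign ws)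
  ft-chain-walk ft [] = walk [] [] [] refl
  ft-chain-walk {ws = s ∷ _} ft (_∷_ c) =
    SignedWalk-++ (ft-step-walk s (ft (proj₁ s))) (ft-chain-walk ft c)

  ClosedWalk : Subset (nE G) → List (Step G) → Set
  ClosedWalk F ws = (∃ λ x → IsChain G x ws x) × StepsIn F ws

  ClosedWalk-split-at-vertex : ∀ {F} xs s ys t zs → depV G s ≡ depV G t →
                               ClosedWalk F (xs ++ s ∷ ys ++ t ∷ zs) →
                               ClosedWalk F (s ∷ ys) × ClosedWalk F (xs ++ t ∷ zs)
  ClosedWalk-split-at-vertex xs s ys t zs s≈t ((x , c) , a) with IsChain-++⁻ xs c
  ... | _ , c-xs , c-rest@(_∷_ _) with IsChain-++⁻ (s ∷ ys) c-rest
  ... | _ , c-sys , c-tzs@(_∷_ _) =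
    ((depV G s , subst (IsChain G (depV G s) (s ∷ ys)) (sym s≈t) c-sys) , ++⁻ˡ (s ∷ ys) a-rest) ,
    ((x , IsChain-++ c-xs (subst (λ v → IsChain G v (t ∷ zs) x) (sym s≈t) c-tzs)) ,
     ++⁺ (++⁻ˡ xs a) (++⁻ʳ (s ∷ ys) a-rest))
    where a-rest = ++⁻ʳ xs a

  ClosedWalk-cancel-backtrack : ∀ {F} xs s ys zs → ClosedWalk F (xs ++ s ∷ ys ++ reverseStep s ∷ zs) →
                                ClosedWalk F ys × ClosedWalk F (xs ++ zs)
  ClosedWalk-cancel-backtrack xs s ys zs ((x , c) , a) with IsChain-++⁻ xs c | ++⁻ʳ xs a
  ... | _ , c-xs , _∷_ c-rest | _ ∷ a-rest with IsChain-++⁻ ys c-rest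
  ... | _ , c-ys , _∷_ c-zs =
    ((arrV G s , subst (IsChain G (arrV G s) ys) (depV-reverseStep s) c-ys) , ++⁻ˡ ys a-rest) ,
    ((x , IsChain-++ c-xs (subst (λ v → IsChain G v zs x) (arrV-reverseStep s) c-zs)) ,
     ++⁺ (++⁻ˡ xs a) (All.tail (++⁻ʳ ys a-rest)))

  ClosedWalkPositive : Subset (nE G) → List (Step G) → Set
  ClosedWalkPositive F ws = ClosedWalk F ws → chainSign ws ≡ ⊕

  _⊏_ : List (Step G) → List (Step G) → Set
  _⊏_ = _<_ on length

  ⊏-wellFounded : WellFounded _⊏_
  ⊏-wellFounded = On.wellFounded length <-wellFounded

  positive-split-at-vertex : ∀ {F} xs s ys t zs → depV G s ≡ depV G t →
                             WfRec _⊏_ (ClosedWalkPositive F) (xs ++ s ∷ ys ++ t ∷ zs) →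
                             ClosedWalkPositive F (xs ++ s ∷ ys ++ t ∷ zs)
  positive-split-at-vertex xs s ys t zs s≈t IH cw
    with ClosedWalk-split-at-vertex xs s ys t zs s≈t cw
  ... | cw-sys , cw-rest = begin
    chainSign (xs ++ s ∷ ys ++ t ∷ zs) ≡⟨ chainSign-excise xs {s ∷ ys} (t ∷ zs) (IH sys⊏ cw-sys) ⟩
    chainSign (xs ++ t ∷ zs)           ≡⟨ IH rest⊏ cw-rest ⟩
    ⊕                                  ∎
    where
    open ≡-Reasoning
    sys⊏ : (s ∷ ys) ⊏ (xs ++ s ∷ ys ++ t ∷ zs)
    sys⊏ = <-≤-trans (length-<-++-∷ (s ∷ ys) t zs) (length-++-≤ʳ (s ∷ ys ++ t ∷ zs) {xs})
    rest⊏ : (xs ++ t ∷ zs) ⊏ (xs ++ s ∷ ys ++ t ∷ zs)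
    rest⊏ = length-++-<-insert xs s ys (t ∷ zs)

  positive-cancel-backtrack : ∀ {F} xs s ys zs →
                              WfRec _⊏_ (ClosedWalkPositive F) (xs ++ s ∷ ys ++ reverseStep s ∷ zs) →
                              ClosedWalkPositive F (xs ++ s ∷ ys ++ reverseStep s ∷ zs)
  positive-cancel-backtrack xs s ys zs IH cw with ClosedWalk-cancel-backtrack xs s ys zs cw
  ... | cw-ys , cw-rest =
    trans (chainSign-cancel-backtrack xs s zs (IH ys⊏ cw-ys)) (IH rest⊏ cw-rest)
    where
    ys⊏ : ys ⊏ (xs ++ s ∷ ys ++ reverseStep s ∷ zs)
    ys⊏ = <-≤-trans (<-trans (length-<-++-∷ ys (reverseStep s) zs) (n<1+n _))
                    (length-++-≤ʳ (s ∷ ys ++ reverseStep s ∷ zs) {xs})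
    rest⊏ : (xs ++ zs) ⊏ (xs ++ s ∷ ys ++ reverseStep s ∷ zs)
    rest⊏ = <-trans (length-++-<-insert xs (reverseStep s) [] zs)
                    (length-++-<-insert xs s ys (reverseStep s ∷ zs))

  positive-cycle : ∀ {F} → Balanced G F → ∀ ws → Unique (edges G ws) → Unique (map (depV G) ws) →
                   ClosedWalkPositive F ws
  positive-cycle bal []       _  _  _        = refl
  positive-cycle bal (s ∷ ws) ue uv (cw , a) =
    trans (chainSign≡⊖^countNeg (s ∷ ws)) (⊖^-even (bal (s ∷ ws) (cw , (λ ()) , a , ue , uv)))

  -- A closed walk without repeated edges or vertices is a cycle; a repeated edge is either traversed twice
  -- in the same direction, repeating a vertex, or back and forth, which cancels out of the sign.
  balanced⇒closedWalk-positive : ∀ {F} → Balanced G F → ∀ ws → ClosedWalkPositive F ws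
  balanced⇒closedWalk-positive {F} bal = WF.All.wfRec ⊏-wellFounded _ (ClosedWalkPositive F) step
    where
    step : ∀ ws → WfRec _⊏_ (ClosedWalkPositive F) ws → ClosedWalkPositive F ws
    step ws IH with unique⊎repetition proj₁ _≟_ ws
    ... | inj₂ (repetition xs s ys t zs refl same) with same-edge⇒≡⊎reversed s t same
    ...   | inj₁ refl = positive-split-at-vertex xs s ys s zs refl IH
    ...   | inj₂ refl = positive-cancel-backtrack xs s ys zs IH
    step ws IH | inj₁ distinct-edges with unique⊎repetition (depV G) _≟_ ws
    ... | inj₂ (repetition xs s ys t zs refl same) = positive-split-at-vertex xs s ys t zs same IH
    ... | inj₁ distinct-vertices = positive-cycle bal ws distinct-edges distinct-vertices

  ft-preserves-balanced : ∀ {F} → FtIsAll G F → Balanced G F → Balanced G (allEdges G)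
  ft-preserves-balanced ft bal ws ((x , c) , _) with ft-chain-walk ft c
  ... | walk ws′ c′ a′ sign≡ = ⊖^≡⊕⇒even _ (begin
    ⊖^ countNeg G (edges G ws) ≡⟨ sym (chainSign≡⊖^countNeg ws) ⟩
    chainSign ws               ≡⟨ sym sign≡ ⟩
    chainSign ws′              ≡⟨ balanced⇒closedWalk-positive bal ws′ ((x , c′) , a′) ⟩
    ⊕                          ∎)
    where open ≡-Reasoning

  allPositive⇒chainSign≡⊕ : ∀ {F ws} → AllPositive G F → StepsIn F ws → chainSign ws ≡ ⊕
  allPositive⇒chainSign≡⊕ pos []       = refl
  allPositive⇒chainSign≡⊕ pos (p ∷ ps) = cong₂ _·_ (pos _ p) (allPositive⇒chainSign≡⊕ pos ps)

  ft-preserves-allPositive : ∀ {F} → FtIsAll G F → AllPositive G F → AllPositive G (allEdges G)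
  ft-preserves-allPositive ft pos e _ with ft-edge-walk (ft e)
  ... | walk _ _ a sign≡ = trans (sym sign≡) (allPositive⇒chainSign≡⊕ pos a)

  Balanced-antimono : ∀ {F F′} → F ⊆ F′ → Balanced G F′ → Balanced G F
  Balanced-antimono F⊆F′ bal ws (cw , ne , a , ue , uv) = bal ws (cw , ne , All.map F⊆F′ a , ue , uv)

  AllPositive-antimono : ∀ {F F′} → F ⊆ F′ → AllPositive G F′ → AllPositive G F
  AllPositive-antimono F⊆F′ pos e e∈F = pos e (F⊆F′ e∈F)

theorem39 : (G : BGraph) (R : Subset (nE G)) → IsTransitiveReduction G R →
            (Balanced G R ⇔ Balanced G (allEdges G)) ×
            (AllPositive G R ⇔ AllPositive G (allEdges G))
theorem39 G R (ft , _) =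
  mk⇔ (ft-preserves-balanced G ft) (Balanced-antimono G ⊆⊤) ,
  mk⇔ (ft-preserves-allPositive G ft) (AllPositive-antimono G ⊆⊤)
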